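{- Let $G$ be a plane graph having at least one face of degree 3. If $G$ has no adjacent $(3,k)$-faces for any $k\leq 5$, then $|E(G)|\geq 2|F(G)|$, where $F(G)$ is the set of faces of $G$.
   Context: For a plane graph $G$, the degree $d(f)$ of a face $f$ is the number of edges in its boundary, cut edges being counted twice. Two faces $f_1,f_2$ of $G$ are adjacent $(i,j)$-faces if $d(f_1)=i$, $d(f_2)=j$, and $f_1$ and $f_2$ have at least one common edge. -}

module Defs where

open import Data.Nat using (ℕ; zero; suc; _+_; _*_; _≤_)
open import Data.Fin using (Fin) renaming (_≟_ to _≟ᶠ_)
open import Data.Bool using (Bool; true; false; not)
open import Data.Product using (_×_; _,_; ∃-syntax)
open import Data.Sum using (_⊎_)
open import Data.List using (List; []; _∷_; length; filter; concatMap; allFin)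
open import Relation.Binary.PropositionalEquality using (_≡_; _≢_)
open import Relation.Binary.Construct.Closure.ReflexiveTransitive using (Star)
open import Function.Bundles using (_⇔_)

-- Plane graphs are encoded combinatorially (rotation systems / combinatorial maps).
-- Darts (half-edges): each edge e : Fin nE has two darts (e , true) and (e , false).
Dart : ℕ → Set
Dart nE = Fin nE × Bool

α : {nE : ℕ} → Dart nE → Dart nE
α (e , b) = (e , not b)

iter : {A : Set} → (A → A) → ℕ → A → A
iter f zero    x = x
iter f (suc k) x = f (iter f k x)

SameOrbit : {A : Set} → (A → A) → A → A → Set
SameOrbit f d d' = ∃[ k ] iter f k d ≡ d'

Surjective : {A B : Set} → (A → B) → Set
Surjective {A} {B} g = (y : B) → ∃[ x ] g x ≡ y

darts : (nE : ℕ) → List (Dart nE)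
darts nE = concatMap (λ e → (e , true) ∷ (e , false) ∷ []) (allFin nE)

-- A finite simple plane graph (isolated vertices omitted, they do not affect
-- edges, faces, face degrees or face adjacency).
record PlaneGraph : Set where
  field
    nE : ℕ
    -- rotation at vertices: a permutation of the darts
    σ    : Dart nE → Dart nE
    σ⁻¹  : Dart nE → Dart nE
    σ-inv₁ : ∀ d → σ (σ⁻¹ d) ≡ d
    σ-inv₂ : ∀ d → σ⁻¹ (σ d) ≡ d
    nV  : ℕ
    vtx : Dart nE → Fin nV                  -- vtx d = tail vertex of dart d
    vtx-surj : Surjective vtx
    vtx-orb  : ∀ d d' → (vtx d ≡ vtx d') ⇔ SameOrbit σ d d'
    no-loop  : ∀ d → vtx d ≢ vtx (α d)
    no-multi : ∀ d d' → vtx d ≡ vtx d' → vtx (α d) ≡ vtx (α d') → d ≡ d'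
    nC   : ℕ
    comp : Dart nE → Fin nC
    comp-surj : Surjective comp
    comp-rel  : ∀ d d' → (comp d ≡ comp d') ⇔
                  Star (λ x y → (y ≡ α x) ⊎ (y ≡ σ x)) d d'
    -- boundary walks = orbits of φ = σ ∘ α
    nO  : ℕ
    orb : Dart nE → Fin nO
    orb-surj : Surjective orb
    orb-rel  : ∀ d d' → (orb d ≡ orb d') ⇔ SameOrbit (λ x → σ (α x)) d d'
    -- every component is embedded in the sphere (genus 0):
    -- Σ over components (V_i - E_i + O_i) = 2 · #components
    euler : nV + nO ≡ 2 * nC + nE
    -- faces of G: each face is a union of boundary walks
    nF   : ℕ
    face : Dart nE → Fin nF
    face-surj : Surjective face
    face-orb  : ∀ d d' → orb d ≡ orb d' → face d ≡ face d'
    -- the bipartite incidence graph (components, faces; one edge per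
    -- boundary walk) is a tree: it has #nodes - 1 edges and is connected
    tree-count : nF + nC ≡ nO + 1
    tree-conn  : ∀ i j → Star (λ i' j' → ∃[ d ] ∃[ d' ]
                    (comp d ≡ i' × comp d' ≡ j' × face d ≡ face d')) i j

open PlaneGraph public

-- degree of a face: number of darts on its boundary
-- (a cut edge has both darts on the same face, so it is counted twice)
deg : (G : PlaneGraph) → Fin (nF G) → ℕ
deg G f = length (filter (λ d → face G d ≟ᶠ f) (darts (nE G)))

AdjacentFaces : (G : PlaneGraph) → Fin (nF G) → Fin (nF G) → Set
AdjacentFaces G f₁ f₂ = ∃[ d ] (face G d ≡ f₁ × face G (α d) ≡ f₂)

-- Discharging. Every dart starts with charge 6, so the darts carry 12|E(G)| in total; then every dart
-- on a triangle takes 2 from the opposite dart of its edge whenever that dart is not on a triangle.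
-- Since no triangle is adjacent to a face of degree at most 5, a triangle ends with 3 · 8, a face of
-- degree 4 or 5 loses nothing and keeps at least 4 · 6, and a face of degree k ≥ 6 keeps at least 4k.
-- Every face has degree at least 3: in a simple graph a face of degree at most 2 is bounded by a single
-- edge, which is then a whole component, and by connectivity of the component-face tree it is all of G.
-- Hence 24|F(G)| ≤ 12|E(G)|.
module Submission where

open import Defs
open import Data.Bool using (Bool; true; false; if_then_else_)
import Data.Bool.Properties as Bool
open import Data.Empty using (⊥; ⊥-elim)
open import Data.Fin using (Fin; zero; suc) renaming (_≟_ to _≟ᶠ_)
open import Data.Fin.Patterns using (0F; 1F; 2F)
import Data.Fin.Properties as Fin
open import Data.List using (List; []; _∷_; length; map; filter; concatMap; allFin; lookup)
open import Data.List.Properties using (length-tabulate)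
open import Data.List.Membership.Propositional using (_∈_)
open import Data.List.Membership.Propositional.Properties
  using (∈-allFin; ∈-concatMap⁺; ∈-filter⁺; ∈-filter⁻)
open import Data.List.Relation.Unary.All as All using (All; []; _∷_)
open import Data.List.Relation.Unary.Any as Any using (here; there; index)
open import Data.List.Relation.Unary.Any.Properties using (lookup-index)
open import Data.Nat using (ℕ; zero; suc; _+_; _*_; _≤_; _≟_; _≤?_; z≤n; s≤s)
open import Data.Nat.ListAction using (sum)
open import Data.Nat.Properties
open import Algebra.Properties.CommutativeMonoid.Sum +-0-commutativeMonoid
  using (sum-syntax; ∑-distrib-+; sum-cong-≗; sum-replicate-zero)
open import Data.Product using (_×_; _,_; proj₁; proj₂; ∃-syntax)
open import Data.Product.Properties using (≡-dec)
open import Data.Sum using (_⊎_; inj₁; inj₂)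
open import Function using (_∘_; id)
open import Function.Bundles using (Equivalence)
open import Function.Definitions using (Injective)
open import Relation.Binary.Construct.Closure.ReflexiveTransitive using (fold)
open import Relation.Binary.Definitions using (DecidableEquality)
open import Relation.Binary.PropositionalEquality
  using (_≡_; _≢_; refl; sym; trans; cong; cong₂; subst; ≢-sym; module ≡-Reasoning)
open import Relation.Nullary using (¬_; yes; no; does; contradiction)
open import Relation.Nullary.Decidable using (dec-true; dec-false)

open Equivalence using (to; from)

module _ {A : Set} where

  injection⇒≤length : ∀ {k} (xs : List A) (f : Fin k → A) →
                      Injective _≡_ _≡_ f → (∀ i → f i ∈ xs) → k ≤ length xs
  injection⇒≤length {k} xs f f-inj f∈xs with k ≤? length xs
  ... | yes k≤ = k≤
  ... | no k≰ with Fin.pigeonhole (≰⇒> k≰) (index ∘ f∈xs)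
  ...   | i , j , i<j , same-index = contradiction (f-inj fi≡fj) (Fin.<⇒≢ i<j)
    where
    open ≡-Reasoning
    fi≡fj : f i ≡ f j
    fi≡fj = begin
      f i                         ≡⟨ lookup-index (f∈xs i) ⟩
      lookup xs (index (f∈xs i))  ≡⟨ cong (lookup xs) same-index ⟩
      lookup xs (index (f∈xs j))  ≡⟨ lookup-index (f∈xs j) ⟨
      f j                         ∎

  three-distinct⇒3≤length : ∀ {a b c} (xs : List A) → a ≢ b → a ≢ c → b ≢ c →
                            a ∈ xs → b ∈ xs → c ∈ xs → 3 ≤ length xs
  three-distinct⇒3≤length {a} {b} {c} xs a≢b a≢c b≢c a∈ b∈ c∈ =
    injection⇒≤length xs abc abc-injective abc-∈
    where
    abc : Fin 3 → A
    abc 0F = a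
    abc 1F = b
    abc 2F = c

    abc-injective : Injective _≡_ _≡_ abc
    abc-injective {0F} {0F} _ = refl
    abc-injective {0F} {1F} e = contradiction e a≢b
    abc-injective {0F} {2F} e = contradiction e a≢c
    abc-injective {1F} {0F} e = contradiction (sym e) a≢b
    abc-injective {1F} {1F} _ = refl
    abc-injective {1F} {2F} e = contradiction e b≢c
    abc-injective {2F} {0F} e = contradiction (sym e) a≢c
    abc-injective {2F} {1F} e = contradiction (sym e) b≢c
    abc-injective {2F} {2F} _ = refl

    abc-∈ : ∀ i → abc i ∈ xs
    abc-∈ 0F = a∈
    abc-∈ 1F = b∈
    abc-∈ 2F = c∈

  length*≤sum : (w : A → ℕ) (c : ℕ) {xs : List A} →
                All (λ x → c ≤ w x) xs → length xs * c ≤ sum (map w xs)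
  length*≤sum w c []           = z≤n
  length*≤sum w c (c≤wx ∷ c≤w) = +-mono-≤ c≤wx (length*≤sum w c c≤w)

n*≤∑ : ∀ n (g : Fin n → ℕ) (c : ℕ) → (∀ i → c ≤ g i) → n * c ≤ ∑[ i < n ] g i
n*≤∑ zero    g c c≤g = z≤n
n*≤∑ (suc n) g c c≤g = +-mono-≤ (c≤g zero) (n*≤∑ n (g ∘ suc) c (c≤g ∘ suc))

∑-indicator : ∀ {n} (j : Fin n) (c : ℕ) → ∑[ i < n ] (if does (j ≟ᶠ i) then c else 0) ≡ c
∑-indicator {suc n} zero    c = trans (cong (c +_) (sum-replicate-zero n)) (+-identityʳ c)
∑-indicator {suc n} (suc j) c = ∑-indicator j c

module _ {A : Set} {n : ℕ} (label : A → Fin n) (w : A → ℕ) where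

  fibre-sum : Fin n → List A → ℕ
  fibre-sum i xs = sum (map w (filter (λ x → label x ≟ᶠ i) xs))

  fibre-sum-∷ : ∀ x xs i →
                fibre-sum i (x ∷ xs) ≡ (if does (label x ≟ᶠ i) then w x else 0) + fibre-sum i xs
  fibre-sum-∷ x xs i with does (label x ≟ᶠ i)
  ... | true  = refl
  ... | false = refl

  ∑-fibre-sum : ∀ xs → ∑[ i < n ] fibre-sum i xs ≡ sum (map w xs)
  ∑-fibre-sum []       = sum-replicate-zero n
  ∑-fibre-sum (x ∷ xs) = begin
    ∑[ i < n ] fibre-sum i (x ∷ xs)
      ≡⟨ sum-cong-≗ (fibre-sum-∷ x xs) ⟩
    ∑[ i < n ] ((if does (label x ≟ᶠ i) then w x else 0) + fibre-sum i xs)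
      ≡⟨ ∑-distrib-+ (λ i → if does (label x ≟ᶠ i) then w x else 0) (λ i → fibre-sum i xs) ⟩
    ∑[ i < n ] (if does (label x ≟ᶠ i) then w x else 0) + ∑[ i < n ] fibre-sum i xs
      ≡⟨ cong₂ _+_ (∑-indicator (label x) (w x)) (∑-fibre-sum xs) ⟩
    w x + sum (map w xs) ∎
    where open ≡-Reasoning

α-involutive : ∀ {m} (x : Dart m) → α (α x) ≡ x
α-involutive (e , b) = cong (e ,_) (Bool.not-involutive b)

α-fixpoint-free : ∀ {m} (x : Dart m) → α x ≢ x
α-fixpoint-free (e , true)  ()
α-fixpoint-free (e , false) ()

_≟ᵈ_ : ∀ {m} → DecidableEquality (Dart m)
_≟ᵈ_ = ≡-dec _≟ᶠ_ Bool._≟_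

∈-darts : ∀ {m} (x : Dart m) → x ∈ darts m
∈-darts (e , b) = ∈-concatMap⁺ (λ e → (e , true) ∷ (e , false) ∷ []) (Any.map (λ { refl → both-darts b }) (∈-allFin e))
  where
  both-darts : ∀ b → (e , b) ∈ (e , true) ∷ (e , false) ∷ []
  both-darts true  = here refl
  both-darts false = there (here refl)

sum-darts : ∀ {m} (w : Dart m → ℕ) (c : ℕ) → (∀ x → w x + w (α x) ≡ c) → sum (map w (darts m)) ≡ m * c
sum-darts {m} w c edge≡c = trans (sum-pairs (allFin m)) (cong (_* c) (length-tabulate {n = m} id))
  where
  sum-pairs : ∀ es → sum (map w (concatMap (λ e → (e , true) ∷ (e , false) ∷ []) es)) ≡ length es * c
  sum-pairs []       = refl
  sum-pairs (e ∷ es) = begin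
    w (e , true) + (w (e , false) + _) ≡⟨ +-assoc (w (e , true)) _ _ ⟨
    w (e , true) + w (e , false) + _   ≡⟨ cong₂ _+_ (edge≡c (e , true)) (sum-pairs es) ⟩
    c + length es * c                  ∎
    where open ≡-Reasoning

module _ (G : PlaneGraph) where

  φ : Dart (nE G) → Dart (nE G)
  φ x = σ G (α x)

  vtx-σ : ∀ x → vtx G (σ G x) ≡ vtx G x
  vtx-σ x = sym (from (vtx-orb G x (σ G x)) (1 , refl))

  face-φ : ∀ x → face G (φ x) ≡ face G x
  face-φ x = sym (face-orb G x (φ x) (from (orb-rel G x (φ x)) (1 , refl)))

  φ-fixpoint-free : ∀ x → φ x ≢ x
  φ-fixpoint-free x φx≡x = no-loop G x (trans (cong (vtx G) (sym φx≡x)) (vtx-σ (α x)))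

  -- No parallel edges: the darts φ x and α x start at the same vertex and end at vtx x.
  φ-involutive⇒φ≡α : ∀ x → φ (φ x) ≡ x → φ x ≡ α x
  φ-involutive⇒φ≡α x φφx≡x = no-multi G (φ x) (α x) (vtx-σ (α x)) (begin
    vtx G (α (φ x))     ≡⟨ vtx-σ (α (φ x)) ⟨
    vtx G (φ (φ x))     ≡⟨ cong (vtx G) φφx≡x ⟩
    vtx G x             ≡⟨ cong (vtx G) (α-involutive x) ⟨
    vtx G (α (α x))     ∎)
    where open ≡-Reasoning

  three-distinct⇒3≤deg : ∀ {f x y z} → face G x ≡ f → face G y ≡ f → face G z ≡ f →
                         x ≢ y → x ≢ z → y ≢ z → 3 ≤ deg G f
  three-distinct⇒3≤deg {f} x∈f y∈f z∈f x≢y x≢z y≢z =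
    three-distinct⇒3≤length _ x≢y x≢z y≢z (on-f x∈f) (on-f y∈f) (on-f z∈f)
    where
    on-f : ∀ {x} → face G x ≡ f → x ∈ filter (λ d → face G d ≟ᶠ f) (darts (nE G))
    on-f {x} x∈f = ∈-filter⁺ (λ d → face G d ≟ᶠ f) (∈-darts x) x∈f

  same-component : (Q : Dart (nE G) → Set) → (∀ x → Q x → Q (α x)) → (∀ x → Q x → Q (σ G x)) →
                   ∀ {x y} → comp G x ≡ comp G y → Q x → Q y
  same-component Q α-closed σ-closed {x} {y} cx≡cy =
    fold (λ x y → Q x → Q y) step id (to (comp-rel G x y) cx≡cy)
    where
    step : ∀ {x y z} → (y ≡ α x) ⊎ (y ≡ σ G x) → (Q y → Q z) → Q x → Q z
    step (inj₁ refl) Qy→Qz = Qy→Qz ∘ α-closed _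
    step (inj₂ refl) Qy→Qz = Qy→Qz ∘ σ-closed _

  -- Closure under α and σ puts every component that meets f on f; the component-face tree is connected.
  closed-face-is-everything : ∀ {f} → (∀ x → face G x ≡ f → face G (α x) ≡ f) →
                              (∀ x → face G x ≡ f → face G (σ G x) ≡ f) →
                              ∀ x → face G x ≡ f
  closed-face-is-everything {f} α-closed σ-closed x =
    fold (λ i j → OnF i → OnF j) step id (tree-conn G (comp G d) (comp G x))
      (λ cy≡cd → within (sym cy≡cd) d-on-f) {x} refl
    where
    OnF : Fin (nC G) → Set
    OnF i = ∀ {y} → comp G y ≡ i → face G y ≡ f
    within = same-component (λ y → face G y ≡ f) α-closed σ-closed
    d = proj₁ (face-surj G f)
    d-on-f = proj₂ (face-surj G f)
    step : ∀ {i j k} → ∃[ e ] ∃[ e' ] (comp G e ≡ i × comp G e' ≡ j × face G e ≡ face G e') →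
           (OnF j → OnF k) → OnF i → OnF k
    step (e , e' , ce , ce' , fe≡fe') onj→onk oni =
      onj→onk (λ cy≡j → within (trans ce' (sym cy≡j)) (trans (sym fe≡fe') (oni ce)))

  short-face-is-everything : ∀ {f} → deg G f ≤ 2 → ∀ x → face G x ≡ f
  short-face-is-everything {f} deg≤2 = closed-face-is-everything α-closed σ-closed
    where
    no-three : ∀ {x y z} → face G x ≡ f → face G y ≡ f → face G z ≡ f →
               x ≢ y → x ≢ z → y ≢ z → ⊥
    no-three x∈f y∈f z∈f x≢y x≢z y≢z =
      <⇒≱ (s≤s deg≤2) (three-distinct⇒3≤deg x∈f y∈f z∈f x≢y x≢z y≢z)
    d = proj₁ (face-surj G f)
    d-on-f = proj₂ (face-surj G f)
    φd-on-f = trans (face-φ d) d-on-f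
    φφd≡d : φ (φ d) ≡ d
    φφd≡d with φ (φ d) ≟ᵈ d
    ... | yes φφd≡d = φφd≡d
    ... | no  φφd≢d = ⊥-elim (no-three d-on-f φd-on-f (trans (face-φ (φ d)) φd-on-f)
                        (≢-sym (φ-fixpoint-free d)) (≢-sym φφd≢d) (≢-sym (φ-fixpoint-free (φ d))))
    φd≡αd = φ-involutive⇒φ≡α d φφd≡d
    αd-on-f = trans (cong (face G) (sym φd≡αd)) φd-on-f
    σd≡d : σ G d ≡ d
    σd≡d = trans (cong (σ G) (sym (α-involutive d))) (trans (cong φ (sym φd≡αd)) φφd≡d)
    on-f⇒d-or-αd : ∀ {x} → face G x ≡ f → x ≡ d ⊎ x ≡ α d
    on-f⇒d-or-αd {x} x-on-f with x ≟ᵈ d | x ≟ᵈ α d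
    ... | yes x≡d | _        = inj₁ x≡d
    ... | no  _   | yes x≡αd = inj₂ x≡αd
    ... | no  x≢d | no  x≢αd = ⊥-elim (no-three d-on-f αd-on-f x-on-f
                                 (≢-sym (α-fixpoint-free d)) (≢-sym x≢d) (≢-sym x≢αd))
    α-closed : ∀ x → face G x ≡ f → face G (α x) ≡ f
    α-closed x x-on-f with on-f⇒d-or-αd x-on-f
    ... | inj₁ refl = αd-on-f
    ... | inj₂ refl = trans (cong (face G) (α-involutive d)) d-on-f
    σ-closed : ∀ x → face G x ≡ f → face G (σ G x) ≡ f
    σ-closed x x-on-f with on-f⇒d-or-αd x-on-f
    ... | inj₁ refl = trans (cong (face G) σd≡d) d-on-f
    ... | inj₂ refl = φd-on-f

  all-faces-3≤deg : ∃[ f ] 3 ≤ deg G f → ∀ f → 3 ≤ deg G f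
  all-faces-3≤deg (f₀ , 3≤deg-f₀) f with 3 ≤? deg G f
  ... | yes 3≤deg-f = 3≤deg-f
  ... | no  3≰deg-f = subst (λ g → 3 ≤ deg G g) f₀≡f 3≤deg-f₀
    where
    d₀ = proj₁ (face-surj G f₀)
    f₀≡f = trans (sym (proj₂ (face-surj G f₀))) (short-face-is-everything (≤-pred (≰⇒> 3≰deg-f)) d₀)

charge : Bool → Bool → ℕ
charge true  false = 8
charge false true  = 4
charge _     _     = 6

charge-+-swap : ∀ a b → charge a b + charge b a ≡ 12
charge-+-swap true  true  = refl
charge-+-swap true  false = refl
charge-+-swap false true  = refl
charge-+-swap false false = refl

4≤charge : ∀ a b → 4 ≤ charge a b
4≤charge true  true  = s≤s (s≤s (s≤s (s≤s z≤n)))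
4≤charge true  false = s≤s (s≤s (s≤s (s≤s z≤n)))
4≤charge false true  = s≤s (s≤s (s≤s (s≤s z≤n)))
4≤charge false false = s≤s (s≤s (s≤s (s≤s z≤n)))

6≤charge-false : ∀ a → 6 ≤ charge a false
6≤charge-false true  = s≤s (s≤s (s≤s (s≤s (s≤s (s≤s z≤n)))))
6≤charge-false false = ≤-refl

module Discharging (G : PlaneGraph)
  (triangle-neighbours : ∀ f₁ f₂ → AdjacentFaces G f₁ f₂ → deg G f₁ ≡ 3 → ¬ (deg G f₂ ≤ 5)) where

  on-triangle : Dart (nE G) → Bool
  on-triangle x = does (deg G (face G x) ≟ 3)

  weight : Dart (nE G) → ℕ
  weight x = charge (on-triangle x) (on-triangle (α x))

  weight-+-α : ∀ x → weight x + weight (α x) ≡ 12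
  weight-+-α x rewrite α-involutive x = charge-+-swap (on-triangle x) (on-triangle (α x))

  across-small-face : ∀ x → deg G (face G x) ≤ 5 → on-triangle (α x) ≡ false
  across-small-face x deg≤5 = dec-false (deg G (face G (α x)) ≟ 3) (λ deg≡3 →
    triangle-neighbours (face G (α x)) (face G x) (α x , refl , cong (face G) (α-involutive x)) deg≡3 deg≤5)

  weight-on-triangle : ∀ x → deg G (face G x) ≡ 3 → weight x ≡ 8
  weight-on-triangle x deg≡3
    rewrite dec-true (deg G (face G x) ≟ 3) deg≡3
          | across-small-face x (≤-trans (≤-reflexive deg≡3) (m≤m+n 3 2)) = refl

  6≤weight : ∀ x → deg G (face G x) ≤ 5 → 6 ≤ weight x
  6≤weight x deg≤5 rewrite across-small-face x deg≤5 = 6≤charge-false (on-triangle x)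

  face-weight : Fin (nF G) → ℕ
  face-weight f = fibre-sum (face G) weight f (darts (nE G))

  deg*≤face-weight : ∀ f c → (∀ x → face G x ≡ f → c ≤ weight x) → deg G f * c ≤ face-weight f
  deg*≤face-weight f c c≤weight = length*≤sum weight c
    (All.tabulate (λ x∈ → c≤weight _ (proj₂ (∈-filter⁻ (λ d → face G d ≟ᶠ f) {xs = darts (nE G)} x∈))))

  24≤face-weight : ∀ f → 3 ≤ deg G f → 24 ≤ face-weight f
  24≤face-weight f 3≤deg with deg G f ≤? 5 | deg G f ≟ 3
  ... | no  deg≰5 | _ =
    ≤-trans (*-monoˡ-≤ 4 (≰⇒> deg≰5)) (deg*≤face-weight f 4 (λ x _ → 4≤charge _ _))
  ... | yes deg≤5 | yes deg≡3 =
    ≤-trans (≤-reflexive (cong (_* 8) (sym deg≡3)))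
      (deg*≤face-weight f 8 (λ x x-on-f → ≤-reflexive (sym (weight-on-triangle x (trans (cong (deg G) x-on-f) deg≡3)))))
  ... | yes deg≤5 | no  deg≢3 =
    ≤-trans (*-monoˡ-≤ 6 (≤∧≢⇒< 3≤deg (≢-sym deg≢3)))
      (deg*≤face-weight f 6 (λ x x-on-f → 6≤weight x (subst (λ g → deg G g ≤ 5) (sym x-on-f) deg≤5)))

lemma2p1 : (G : PlaneGraph)
    → ∃[ f ] deg G f ≡ 3
    → (∀ f₁ f₂ → AdjacentFaces G f₁ f₂ → deg G f₁ ≡ 3 → ¬ (deg G f₂ ≤ 5))
    → 2 * nF G ≤ nE G
lemma2p1 G (f₃ , deg≡3) triangle-neighbours = *-cancelˡ-≤ 12 (begin
  12 * (2 * nF G)                  ≡⟨ trans (sym (*-assoc 12 2 (nF G))) (*-comm 24 (nF G)) ⟩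
  nF G * 24                        ≤⟨ n*≤∑ (nF G) face-weight 24 (λ f → 24≤face-weight f (all-faces-3≤deg G triangle f)) ⟩
  ∑[ f < nF G ] face-weight f      ≡⟨ ∑-fibre-sum (face G) weight (darts (nE G)) ⟩
  sum (map weight (darts (nE G)))  ≡⟨ sum-darts weight 12 weight-+-α ⟩
  nE G * 12                        ≡⟨ *-comm (nE G) 12 ⟩
  12 * nE G                        ∎)
  where
  open ≤-Reasoning
  open Discharging G triangle-neighbours
  triangle : ∃[ f ] 3 ≤ deg G f
  triangle = f₃ , ≤-reflexive (sym deg≡3)
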